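{- Fix an integer $k\ge 2$ and consider either edge connectivity or vertex connectivity. Let $G=(V,E)$ be a directed graph and $r\in V$ a vertex from which all vertices of $G$ are reachable, and let $G(r)$ be the flow graph rooted at $r$. If $Z$ is a $k$-dominator in $G(r)$, then there exists a set of vertices $T$ with $r\notin T$ that induces a top SCC in $G\setminus Z$.
   Context: Elements are edges (edge connectivity) or vertices (vertex connectivity); $G\setminus Z$ denotes $G$ with the elements of $Z$ removed. A top SCC (tSCC) is a strongly connected component with no incoming edges from outside it. The flow graph $G(r)$ is $G$ with root $r$ and all vertices unreachable from $r$ removed. A $k$-dominator in $G(r)$ is a set $Z$ of fewer than $k$ elements of $G(r)$ (not containing $r$ in the vertex case) that is minimal with respect to inclusion among sets with the property that there is a vertex $u$ of $G(r)$, $u\notin\{r\}\cup Z$, reachable from $r$, such that every path from $r$ to $u$ contains an element of $Z$. -}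

module Defs where

open import Data.Nat using (ℕ; _<_)
open import Data.Fin using (Fin)
open import Data.Fin.Subset using (Subset; _∈_; _∉_; _⊂_; ∣_∣; Nonempty)
open import Data.Product using (Σ; _×_; ∃)
open import Data.Unit using (⊤)
open import Relation.Binary.PropositionalEquality using (_≡_; _≢_)
open import Relation.Nullary using (¬_)

record Graph (n : ℕ) : Set where
  field
    m   : ℕ
    src : Fin m → Fin n
    tgt : Fin m → Fin n
open Graph public

data Mode : Set where
  edgeMode vertexMode : Mode

size : ∀ {n} → Mode → Graph n → ℕ
size {n} vertexMode G = n
size edgeMode G = m G

Elems : ∀ {n} → Mode → Graph n → Set
Elems md G = Subset (size md G)

data Walk {n} (G : Graph n) : Fin n → Fin n → Set where
  nil  : ∀ {x} → Walk G x x
  cons : ∀ {x y} (e : Fin (m G)) → src G e ≡ x → Walk G (tgt G e) y → Walk G x y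

Avoids : ∀ {n} (md : Mode) (G : Graph n) → Elems md G → ∀ {x y} → Walk G x y → Set
Avoids vertexMode G Z {x} nil = x ∉ Z
Avoids vertexMode G Z {x} (cons e _ w) = x ∉ Z × Avoids vertexMode G Z w
Avoids edgeMode G Z nil = ⊤
Avoids edgeMode G Z (cons e _ w) = e ∉ Z × Avoids edgeMode G Z w

VertexNotIn : ∀ {n} (md : Mode) (G : Graph n) → Elems md G → Fin n → Set
VertexNotIn vertexMode G Z v = v ∉ Z
VertexNotIn edgeMode G Z v = ⊤

EdgeAlive : ∀ {n} (md : Mode) (G : Graph n) → Elems md G → Fin (m G) → Set
EdgeAlive vertexMode G Z e = src G e ∉ Z × tgt G e ∉ Z
EdgeAlive edgeMode G Z e = e ∉ Z

ReachIn : ∀ {n} (md : Mode) (G : Graph n) → Elems md G → Fin n → Fin n → Set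
ReachIn md G Z x y = Σ (Walk G x y) (Avoids md G Z)

Separates : ∀ {n} (md : Mode) (G : Graph n) (r : Fin n) → Elems md G → Set
Separates md G r Z =
  ∃ λ u → u ≢ r × VertexNotIn md G Z u × Walk G r u
        × ((w : Walk G r u) → ¬ Avoids md G Z w)

IsKDominator : ∀ {n} (md : Mode) (k : ℕ) (G : Graph n) (r : Fin n) → Elems md G → Set
IsKDominator md k G r Z =
  ∣ Z ∣ < k × VertexNotIn md G Z r × Separates md G r Z
  × (∀ Z′ → Z′ ⊂ Z → ¬ Separates md G r Z′)

IsSCC : ∀ {n} (md : Mode) (G : Graph n) → Elems md G → Subset n → Set
IsSCC md G Z T =
  Nonempty T
  × (∀ x y → x ∈ T → y ∈ T → ReachIn md G Z x y)
  × (∀ x v → x ∈ T → ReachIn md G Z x v → ReachIn md G Z v x → v ∈ T)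

IsTopSCC : ∀ {n} (md : Mode) (G : Graph n) → Elems md G → Subset n → Set
IsTopSCC md G Z T =
  IsSCC md G Z T
  × (∀ e → EdgeAlive md G Z e → tgt G e ∈ T → src G e ∈ T)

-- Only the separating vertex of the dominator matters (neither its size nor
-- its minimality): it gives a vertex u of G ∖ Z that r cannot reach.  Follow a
-- chain u = v₀, v₁, … in G ∖ Z where each vᵢ₊₁ reaches vᵢ but not conversely;
-- the ancestor sets strictly shrink, so the chain stops at a vertex v reached
-- back by all its ancestors.  The ancestors of v then form a top SCC, and r is
-- not among them since r does not even reach u.
module Submission where

open import Defs
open import Data.Nat using (ℕ; _≤_)
open import Data.Fin using (Fin; zero; suc)
open import Data.Fin.Subset using (Subset; inside; outside; _∈_; _∉_; _⊆_; _⊂_; _⊃_)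
open import Data.Fin.Subset.Properties using (_∈?_; _⊂?_)
open import Data.Fin.Subset.Induction using (Acc; acc; ⊂-wellFounded; ⊃-wellFounded)
open import Data.Fin.Properties using (any?; _≟_)
open import Data.Vec.Base using ([]; _∷_; here; there)
open import Data.Product using (Σ; _×_; _,_; proj₁)
open import Data.Sum using (inj₁; inj₂)
open import Data.Unit using (tt)
open import Data.Empty using (⊥-elim)
open import Relation.Nullary using (¬_; Dec; yes; no; contradiction)
open import Relation.Nullary.Decidable using (¬?; _×-dec_; _⊎-dec_)
open import Relation.Binary.PropositionalEquality using (_≡_; refl)

toSubset : ∀ {n} {P : Fin n → Set} → (∀ i → Dec (P i)) → Subset n
toSubset {ℕ.zero}  P? = []
toSubset {ℕ.suc n} P? with P? zero
... | yes _ = inside  ∷ toSubset (λ i → P? (suc i))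
... | no _  = outside ∷ toSubset (λ i → P? (suc i))

∈-toSubset⁺ : ∀ {n} {P : Fin n → Set} (P? : ∀ i → Dec (P i)) {i} → P i → i ∈ toSubset P?
∈-toSubset⁺ {ℕ.suc n} P? {zero} p with P? zero
... | yes _ = here
... | no ¬p = contradiction p ¬p
∈-toSubset⁺ {ℕ.suc n} P? {suc i} p with P? zero
... | yes _ = there (∈-toSubset⁺ (λ j → P? (suc j)) p)
... | no _  = there (∈-toSubset⁺ (λ j → P? (suc j)) p)

∈-toSubset⁻ : ∀ {n} {P : Fin n → Set} (P? : ∀ i → Dec (P i)) {i} → i ∈ toSubset P? → P i
∈-toSubset⁻ {ℕ.suc n} P? {zero} i∈ with P? zero
... | yes p = p
∈-toSubset⁻ {ℕ.suc n} P? {zero} () | no _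
∈-toSubset⁻ {ℕ.suc n} P? {suc i} i∈ with P? zero
∈-toSubset⁻ {ℕ.suc n} P? {suc i} (there i∈) | yes _ = ∈-toSubset⁻ (λ j → P? (suc j)) i∈
∈-toSubset⁻ {ℕ.suc n} P? {suc i} (there i∈) | no _  = ∈-toSubset⁻ (λ j → P? (suc j)) i∈

_++ʷ_ : ∀ {n} {G : Graph n} {x y z} → Walk G x y → Walk G y z → Walk G x z
nil          ++ʷ w′ = w′
cons e eq w  ++ʷ w′ = cons e eq (w ++ʷ w′)

module _ {n} {G : Graph n} where

  vertexNotIn? : ∀ md (Z : Elems md G) v → Dec (VertexNotIn md G Z v)
  vertexNotIn? vertexMode Z v = ¬? (v ∈? Z)
  vertexNotIn? edgeMode   Z v = yes tt

  edgeAlive? : ∀ md (Z : Elems md G) e → Dec (EdgeAlive md G Z e)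
  edgeAlive? vertexMode Z e = ¬? (src G e ∈? Z) ×-dec ¬? (tgt G e ∈? Z)
  edgeAlive? edgeMode   Z e = ¬? (e ∈? Z)

  avoids-nil : ∀ md (Z : Elems md G) {x} → VertexNotIn md G Z x → Avoids md G Z (nil {x = x})
  avoids-nil vertexMode Z x∉Z = x∉Z
  avoids-nil edgeMode   Z _   = tt

  avoids-source : ∀ md (Z : Elems md G) {x y} (w : Walk G x y) →
                  Avoids md G Z w → VertexNotIn md G Z x
  avoids-source vertexMode Z nil          x∉Z       = x∉Z
  avoids-source vertexMode Z (cons _ _ _) (x∉Z , _) = x∉Z
  avoids-source edgeMode   Z _            _         = tt

  avoids-target : ∀ md (Z : Elems md G) {x y} (w : Walk G x y) →
                  Avoids md G Z w → VertexNotIn md G Z y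
  avoids-target vertexMode Z nil          y∉Z      = y∉Z
  avoids-target vertexMode Z (cons _ _ w) (_ , av) = avoids-target vertexMode Z w av
  avoids-target edgeMode   Z _            _        = tt

  avoids-cons⁺ : ∀ md (Z : Elems md G) {y} e (w : Walk G (tgt G e) y) →
                 EdgeAlive md G Z e → Avoids md G Z w → Avoids md G Z (cons e refl w)
  avoids-cons⁺ vertexMode Z e w (src∉Z , _) av = src∉Z , av
  avoids-cons⁺ edgeMode   Z e w e∉Z         av = e∉Z , av

  avoids-cons⁻ : ∀ md (Z : Elems md G) {x y} e (eq : src G e ≡ x) (w : Walk G (tgt G e) y) →
                 Avoids md G Z (cons e eq w) → EdgeAlive md G Z e × Avoids md G Z w
  avoids-cons⁻ vertexMode Z e refl w (src∉Z , av) = (src∉Z , avoids-source vertexMode Z w av) , av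
  avoids-cons⁻ edgeMode   Z e eq   w (e∉Z , av)   = e∉Z , av

  avoids-++ : ∀ md (Z : Elems md G) {x y z} (w : Walk G x y) (w′ : Walk G y z) →
              Avoids md G Z w → Avoids md G Z w′ → Avoids md G Z (w ++ʷ w′)
  avoids-++ vertexMode Z nil          w′ _          av′ = av′
  avoids-++ vertexMode Z (cons _ _ w) w′ (x∉Z , av) av′ = x∉Z , avoids-++ vertexMode Z w w′ av av′
  avoids-++ edgeMode   Z nil          w′ _          av′ = av′
  avoids-++ edgeMode   Z (cons _ _ w) w′ (e∉Z , av) av′ = e∉Z , avoids-++ edgeMode Z w w′ av av′

module Reachability {n} (md : Mode) (G : Graph n) (Z : Elems md G) where

  Survives : Fin n → Set
  Survives = VertexNotIn md G Z

  Alive : Fin (m G) → Set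
  Alive = EdgeAlive md G Z

  infix 4 _↝_
  _↝_ : Fin n → Fin n → Set
  _↝_ = ReachIn md G Z

  ↝-refl : ∀ {x} → Survives x → x ↝ x
  ↝-refl x-ok = nil , avoids-nil md Z x-ok

  ↝-trans : ∀ {x y z} → x ↝ y → y ↝ z → x ↝ z
  ↝-trans (w , av) (w′ , av′) = w ++ʷ w′ , avoids-++ md Z w w′ av av′

  ↝-step : ∀ {y} e → Alive e → tgt G e ↝ y → src G e ↝ y
  ↝-step e alive (w , av) = cons e refl w , avoids-cons⁺ md Z e w alive av

  ↝-source : ∀ {x y} → x ↝ y → Survives x
  ↝-source (w , av) = avoids-source md Z w av

  ↝-target : ∀ {x y} → x ↝ y → Survives y
  ↝-target (w , av) = avoids-target md Z w av

  BackClosed : Subset n → Set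
  BackClosed S = ∀ e → Alive e → tgt G e ∈ S → src G e ∈ S

  backClosed-↝ : ∀ {S x y} → BackClosed S → y ∈ S → x ↝ y → x ∈ S
  backClosed-↝ {S} {y = y} closed y∈S (w , av) = go w av
    where
    go : ∀ {x} (w : Walk G x y) → Avoids md G Z w → x ∈ S
    go nil               _  = y∈S
    go (cons e refl w′) av′ =
      let alive , av″ = avoids-cons⁻ md Z e refl w′ av′ in closed e alive (go w′ av″)

  predecessorClosure : Subset n → Subset n
  predecessorClosure S = toSubset λ v →
    v ∈? S ⊎-dec any? (λ e → edgeAlive? md Z e ×-dec tgt G e ∈? S ×-dec src G e ≟ v)

  backClosure : {P : Fin n → Set} → (∀ e → Alive e → P (tgt G e) → P (src G e)) →
                ∀ S → Acc _⊃_ S → (∀ {s} → s ∈ S → P s) →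
                Σ (Subset n) λ T → S ⊆ T × (∀ {t} → t ∈ T → P t) × BackClosed T
  backClosure {P} P-back S (acc rec) S⊆P with S ⊂? predecessorClosure S
  ... | yes S⊂S′ =
    let T , S′⊆T , T⊆P , closed = backClosure P-back _ (rec S⊂S′) S′⊆P
    in  T , (λ s∈S → S′⊆T (proj₁ S⊂S′ s∈S)) , T⊆P , closed
    where
    S′⊆P : ∀ {s} → s ∈ predecessorClosure S → P s
    S′⊆P s∈ with ∈-toSubset⁻ _ s∈
    ... | inj₁ s∈S                      = S⊆P s∈S
    ... | inj₂ (e , alive , t∈S , refl) = P-back e alive (S⊆P t∈S)
  ... | no S⊄S′ = S , (λ s∈S → s∈S) , S⊆P , closed
    where
    closed : BackClosed S
    closed e alive t∈S with src G e ∈? S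
    ... | yes s∈S = s∈S
    ... | no  s∉S = contradiction
      ((λ {s} s∈S → ∈-toSubset⁺ _ (inj₁ s∈S)) ,
       src G e , ∈-toSubset⁺ _ (inj₂ (e , alive , t∈S , refl)) , s∉S) S⊄S′

  _↝?_ : ∀ x y → Dec (x ↝ y)
  x ↝? y with vertexNotIn? md Z y
  ... | no y-dead = no (λ x↝y → y-dead (↝-target x↝y))
  ... | yes y-ok
    with backClosure ↝-step ⁅y⁆ (⊃-wellFounded ⁅y⁆) ⁅y⁆⊆ancestors
    where
    ⁅y⁆ = toSubset (_≟ y)
    ⁅y⁆⊆ancestors : ∀ {s} → s ∈ ⁅y⁆ → s ↝ y
    ⁅y⁆⊆ancestors s∈ with ∈-toSubset⁻ (_≟ y) s∈
    ... | refl = ↝-refl y-ok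
  ... | T , ⁅y⁆⊆T , T⊆ancestors , closed with x ∈? T
  ... | yes x∈T = yes (T⊆ancestors x∈T)
  ... | no  x∉T = no (λ x↝y → x∉T (backClosed-↝ closed (⁅y⁆⊆T (∈-toSubset⁺ (_≟ y) refl)) x↝y))

  ancestors : Fin n → Subset n
  ancestors v = toSubset (_↝? v)

  ancestors-⊂ : ∀ {v w} → Survives v → w ↝ v → ¬ v ↝ w → ancestors w ⊂ ancestors v
  ancestors-⊂ v-ok w↝v v↝̸w =
    (λ u∈ → ∈-toSubset⁺ _ (↝-trans (∈-toSubset⁻ _ u∈) w↝v)) ,
    _ , ∈-toSubset⁺ _ (↝-refl v-ok) , (λ v∈ → v↝̸w (∈-toSubset⁻ _ v∈))

  ancestors-isTopSCC : ∀ {v} → Survives v → (∀ {w} → w ↝ v → v ↝ w) →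
                       IsTopSCC md G Z (ancestors v)
  ancestors-isTopSCC {v} v-ok reachedBack =
    ((v , into (↝-refl v-ok)) , strong , maximal) , top
    where
    into : ∀ {u} → u ↝ v → u ∈ ancestors v
    into = ∈-toSubset⁺ _
    outof : ∀ {u} → u ∈ ancestors v → u ↝ v
    outof = ∈-toSubset⁻ _
    strong : ∀ x y → x ∈ ancestors v → y ∈ ancestors v → x ↝ y
    strong x y x∈ y∈ = ↝-trans (outof x∈) (reachedBack (outof y∈))
    maximal : ∀ x u → x ∈ ancestors v → x ↝ u → u ↝ x → u ∈ ancestors v
    maximal x u x∈ _ u↝x = into (↝-trans u↝x (outof x∈))
    top : ∀ e → Alive e → tgt G e ∈ ancestors v → src G e ∈ ancestors v
    top e alive t∈ = into (↝-step e alive (outof t∈))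

  topSCC-above : ∀ v → Acc _⊂_ (ancestors v) → Survives v →
                 Σ (Subset n) λ T → (∀ {t} → t ∈ T → t ↝ v) × IsTopSCC md G Z T
  topSCC-above v (acc rec) v-ok with any? (λ w → w ↝? v ×-dec ¬? (v ↝? w))
  ... | yes (w , w↝v , v↝̸w) =
    let T , T⊆ancestors , isTop = topSCC-above w (rec (ancestors-⊂ v-ok w↝v v↝̸w)) (↝-source w↝v)
    in  T , (λ t∈T → ↝-trans (T⊆ancestors t∈T) w↝v) , isTop
  ... | no noEscape = ancestors v , ∈-toSubset⁻ _ , ancestors-isTopSCC v-ok reachedBack
    where
    reachedBack : ∀ {w} → w ↝ v → v ↝ w
    reachedBack {w} w↝v with v ↝? w
    ... | yes v↝w = v↝w
    ... | no  v↝̸w = ⊥-elim (noEscape (w , w↝v , v↝̸w))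

mainTheorem9 : (k : ℕ) → 2 ≤ k → (md : Mode) → (n : ℕ) → (G : Graph n) → (r : Fin n)
    → (∀ v → Walk G r v)
    → (Z : Elems md G) → IsKDominator md k G r Z
    → Σ (Subset n) (λ T → r ∉ T × IsTopSCC md G Z T)
mainTheorem9 k _ md n G r _ Z (_ , _ , (u , _ , u-ok , _ , noAvoidingWalk) , _) =
  let T , T⊆ancestors , isTop = topSCC-above u (⊂-wellFounded _) u-ok
  in  T , (λ r∈T → r↝̸u (T⊆ancestors r∈T)) , isTop
  where
  open Reachability md G Z
  r↝̸u : ¬ r ↝ u
  r↝̸u (w , av) = noAvoidingWalk w av
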